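{- Let $n \ge 2$ be even. Then \[ T(n,n+1) = \begin{cases} \{(n-2)/3\}, & \text{if } n \equiv 2 \pmod 3,\\ \emptyset, & \text{otherwise}.\end{cases} \] In particular, $s(n+1) = s(n)$ if $n \equiv 2 \pmod 3$, and $s(n+1) = s(n)+1$ otherwise.
   Context: $n \bmod k$ denotes the least nonnegative remainder of $n$ upon division by $k$. $S(n) := \{ n \bmod k : k \in \{1,2,\ldots,\lfloor n/2\rfloor\}\}$, $s(n) := |S(n)|$, and $T(n,n+1) := \{ r : r \in S(n) \text{ and } r+1 \notin S(n+1)\}$. -}

module Defs where

open import Data.Nat using (ℕ; suc; _≟_)
open import Data.Nat.DivMod using (_/_; _%_)
open import Data.List using (List; map; upTo; length; deduplicate)
open import Data.List.Membership.Propositional using (_∈_)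
open import Data.Product using (_×_)
open import Relation.Nullary using (¬_)

-- S(n) = { n mod k : k ∈ {1, …, ⌊n/2⌋} }, as a list (k = suc i, i < ⌊n/2⌋)
S : ℕ → List ℕ
S n = map (λ i → n % suc i) (upTo (n / 2))

s : ℕ → ℕ
s n = length (deduplicate _≟_ (S n))

_∈T[_,_] : ℕ → ℕ → ℕ → Set
r ∈T[ n , m ] = (r ∈ S n) × ¬ (suc r ∈ S m)

{-# OPTIONS --safe #-}
module Submission where

open import Defs
open import Data.Nat using (ℕ; zero; suc; _+_; _*_; _∸_; _≤_; _<_; NonZero; s≤s)
open import Data.Nat.Properties
open import Data.Nat.DivMod
  using ( _/_; _%_; m≡m%n+[m/n]*n; [m+kn]%n≡m%n; m<n⇒m%n≡m; m*n%n≡0; m*n/n≡m; +-distrib-/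
        ; m%n<n; n%1≡0; %-congˡ)
open import Data.Nat.Divisibility using (_∣_; divides)
open import Data.Nat.Tactic.RingSolver using (solve-∀)
open import Data.Product using (_×_; _,_; proj₁; proj₂; ∃-syntax)
open import Data.Sum using (_⊎_; inj₁; inj₂)
open import Data.List using (List; []; _∷_; map; filter; length; deduplicate)
open import Data.List.Properties using (length-map)
open import Data.List.Membership.Propositional using (_∈_; _∉_)
open import Data.List.Membership.Propositional.Properties
  using (∈-map⁻; ∈-map⁺; ∈-upTo⁻; ∈-upTo⁺; ∈-filter⁻; ∈-filter⁺; ∈-deduplicate⁻; ∈-deduplicate⁺)
open import Data.List.Membership.Propositional.Properties.WithK using (unique∧set⇒bag)
open import Data.List.Membership.DecPropositional _≟_ using (_∈?_)
open import Data.List.Relation.Binary.BagAndSetEquality using (_∼[_]_; set; ∼bag⇒↭)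
open import Data.List.Relation.Binary.Permutation.Propositional.Properties using (↭-length)
open import Data.List.Relation.Unary.All using ([]; universal)
open import Data.List.Relation.Unary.All.Properties using () renaming (map⁺ to All-map⁺)
open import Data.List.Relation.Unary.AllPairs using ([]; _∷_)
open import Data.List.Relation.Unary.Any using (here; there)
open import Data.List.Relation.Unary.Unique.Propositional using (Unique)
open import Data.List.Relation.Unary.Unique.Propositional.Properties
  using (filter⁺) renaming (map⁺ to Unique-map⁺)
open import Data.List.Relation.Unary.Unique.DecPropositional.Properties using (deduplicate-!)
open import Function.Bundles using (_⇔_; mk⇔; Equivalence)
open import Function.Construct.Composition using (_⇔-∘_)
open import Function.Construct.Symmetry using (⇔-sym)
open import Relation.Binary.Definitions using (DecidableEquality)
open import Relation.Binary.PropositionalEquality using (_≡_; refl; sym; trans; cong; subst; module ≡-Reasoning)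
open import Relation.Nullary using (¬_; yes; no; contradiction)
open import Relation.Unary using (Pred; Decidable)
open import Relation.Unary.Properties using (∁?)

open Equivalence using (to; from)

-- For even n = 2h, S(n) and S(n+1) are both the residues modulo k = 1, …, h, and
-- (n+1) mod k = (n mod k) + 1 unless k ∣ n+1, in which case it is 0.  Hence
-- S(n+1) = {0} ∪ {r+1 : r ∈ S(n) ∖ T(n,n+1)}, so s(n+1) + |T(n,n+1)| = s(n) + 1.
-- A residue r = n mod k lies in T(n,n+1) only if r = k-1 with n+1 = qk; q is odd
-- since n+1 is, q = 1 is excluded by k ≤ h, and q ≥ 5 would give 2k ≤ h with
-- (n+1) mod 2k = k = r+1.  So n+1 = 3(r+1); conversely such an r is n mod (r+1),
-- while (n+1) mod k = r+1 with r+1 < k ≤ h would force k = 2(r+1) > h.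

module _ {a} {A : Set a} where

  unique∧set⇒length≡ : {xs ys : List A} → Unique xs → Unique ys → xs ∼[ set ] ys →
                       length xs ≡ length ys
  unique∧set⇒length≡ xs! ys! xs∼ys = ↭-length (∼bag⇒↭ (unique∧set⇒bag xs! ys! xs∼ys))

  set⇒length-deduplicate≡ : (_≟_ : DecidableEquality A) {xs ys : List A} → Unique ys →
                       xs ∼[ set ] ys → length (deduplicate _≟_ xs) ≡ length ys
  set⇒length-deduplicate≡ _≟_ {xs} ys! xs∼ys = unique∧set⇒length≡ (deduplicate-! _≟_ xs) ys!
    (mk⇔ (λ x∈ → to xs∼ys (∈-deduplicate⁻ _≟_ xs x∈)) (λ x∈ → ∈-deduplicate⁺ _≟_ (from xs∼ys x∈)))

  unique∧⇔≡⇒length≡1 : {xs : List A} {c : A} → Unique xs → (∀ {x} → x ∈ xs ⇔ x ≡ c) →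
                        length xs ≡ 1
  unique∧⇔≡⇒length≡1 xs! ∈⇔≡ = unique∧set⇒length≡ xs! ([] ∷ [])
    (mk⇔ (λ x∈ → here (to ∈⇔≡ x∈)) λ { (here x≡c) → from ∈⇔≡ x≡c ; (there ()) })

  ∉⇒length≡0 : {xs : List A} → (∀ {x} → x ∉ xs) → length xs ≡ 0
  ∉⇒length≡0 {[]}    _  = refl
  ∉⇒length≡0 {_ ∷ _} ∉xs = contradiction (here refl) ∉xs

  length-filter+length-filter-∁ : ∀ {p} {P : Pred A p} (P? : Decidable P) xs →
    length (filter P? xs) + length (filter (∁? P?) xs) ≡ length xs
  length-filter+length-filter-∁ P? [] = refl
  length-filter+length-filter-∁ P? (x ∷ xs) with P? x
  ... | yes _ = cong suc (length-filter+length-filter-∁ P? xs)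
  ... | no _  = trans (+-suc _ _) (cong suc (length-filter+length-filter-∁ P? xs))

m≡r+q*k⇒m%k≡r : ∀ {m r q k} .{{_ : NonZero k}} → r < k → m ≡ r + q * k → m % k ≡ r
m≡r+q*k⇒m%k≡r {r = r} {q} {k} r<k refl = trans ([m+kn]%n≡m%n r q k) (m<n⇒m%n≡m r<k)

%-suc-cases : ∀ m k .{{_ : NonZero k}} →
              suc m % k ≡ suc (m % k) ⊎ (suc (m % k) ≡ k × suc m ≡ suc (m / k) * k)
%-suc-cases m k with m≤n⇒m<n∨m≡n (m%n<n m k)
... | inj₁ 1+r<k  = inj₁ (m≡r+q*k⇒m%k≡r {q = m / k} 1+r<k (cong suc (m≡m%n+[m/n]*n m k)))
... | inj₂ 1+r≡k = inj₂ (1+r≡k , subst (λ x → suc m ≡ x + m / k * k) 1+r≡k (cong suc (m≡m%n+[m/n]*n m k)))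

even-or-odd : ∀ q → (∃[ p ] q ≡ p * 2) ⊎ (∃[ p ] q ≡ suc (p * 2))
even-or-odd zero = inj₁ (0 , refl)
even-or-odd (suc q) with even-or-odd q
... | inj₁ (p , refl) = inj₂ (p , refl)
... | inj₂ (p , refl) = inj₁ (suc p , refl)

[1+h*2]/2≡h : ∀ h → suc (h * 2) / 2 ≡ h
[1+h*2]/2≡h h = begin
  (1 + h * 2) / 2    ≡⟨ +-distrib-/ 1 (h * 2) (subst (λ x → 1 + x < 2) (sym (m*n%n≡0 h 2)) ≤-refl) ⟩
  1 / 2 + h * 2 / 2  ≡⟨ m*n/n≡m h 2 ⟩
  h                  ∎
  where open ≡-Reasoning

odd-multiple-cases : ∀ {h i} q → suc i ≤ h → suc (h * 2) ≡ q * suc i →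
                     h * 2 ≡ 2 + i * 3 ⊎ (suc i * 2 ≤ h × suc (h * 2) % (suc i * 2) ≡ suc i)
odd-multiple-cases {h} {i} q 1+i≤h eq with even-or-odd q
... | inj₁ (p , refl) = contradiction (begin
  2 * (p * suc i)  ≡⟨ reassoc p (suc i) ⟩
  p * 2 * suc i    ≡⟨ sym eq ⟩
  suc (h * 2)      ≡⟨ cong suc (*-comm h 2) ⟩
  suc (2 * h)      ∎) (even≢odd (p * suc i) h)
  where
  open ≡-Reasoning
  reassoc : ∀ p k → 2 * (p * k) ≡ p * 2 * k
  reassoc = solve-∀
... | inj₂ (0 , refl) =
  contradiction (subst (_≤ h) (trans (sym (+-identityʳ (suc i))) (sym eq)) 1+i≤h)
                (<⇒≱ (s≤s (m≤m*n h 2)))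
... | inj₂ (1 , refl) = inj₁ (suc-injective (trans eq (thrice i)))
  where
  thrice : ∀ i → 3 * suc i ≡ 3 + i * 3
  thrice = solve-∀
... | inj₂ (suc (suc p) , refl) =
  inj₂ ( *-cancelʳ-≤ (suc i * 2) h 2 (subst (suc i * 2 * 2 ≤_) (sym h*2≡) (m≤m+n _ _))
       , m≡r+q*k⇒m%k≡r {q = 2 + p} (m<m*n (suc i) 2 ≤-refl) (trans eq (split₁ p i)))
  where
  split₁ : ∀ p i → suc ((2 + p) * 2) * suc i ≡ suc i + (2 + p) * (suc i * 2)
  split₁ = solve-∀
  split₂ : ∀ p i → suc ((2 + p) * 2) * suc i ≡ suc (suc i * 2 * 2 + (i + p * (suc i * 2)))
  split₂ = solve-∀
  h*2≡ : h * 2 ≡ suc i * 2 * 2 + (i + p * (suc i * 2))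
  h*2≡ = suc-injective (trans eq (split₂ p i))

m*3%k≡m⇒k≡m*2 : ∀ {m k} .{{_ : NonZero m}} .{{_ : NonZero k}} → m < k → m * 3 % k ≡ m → k ≡ m * 2
m*3%k≡m⇒k≡m*2 {m@(suc _)} {k} m<k e = cofactor (m * 3 / k) (+-cancelˡ-≡ m _ _ (begin
  m + m * 3 / k * k          ≡⟨ cong (_+ m * 3 / k * k) (sym e) ⟩
  m * 3 % k + m * 3 / k * k  ≡⟨ sym (m≡m%n+[m/n]*n (m * 3) k) ⟩
  m * 3                      ≡⟨ triple m ⟩
  m + m * 2                  ∎))
  where
  open ≡-Reasoning
  triple : ∀ m → m * 3 ≡ m + m * 2
  triple = solve-∀
  cofactor : ∀ q → q * k ≡ m * 2 → k ≡ m * 2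
  cofactor 0 ()
  cofactor 1 e = trans (sym (+-identityʳ k)) e
  cofactor (suc (suc q)) e =
    contradiction (subst (k * 2 ≤_) (trans (*-comm k (2 + q)) e) (*-monoʳ-≤ k (m≤m+n 2 q)))
                  (<⇒≱ (*-monoˡ-< 2 m<k))

n%3≡2×r≡[n∸2]/3⇔n≡2+r*3 : ∀ {n r} → (n % 3 ≡ 2 × r ≡ (n ∸ 2) / 3) ⇔ n ≡ 2 + r * 3
n%3≡2×r≡[n∸2]/3⇔n≡2+r*3 {n} = mk⇔ to′ from′
  where
  to′ : ∀ {r} → n % 3 ≡ 2 × r ≡ (n ∸ 2) / 3 → n ≡ 2 + r * 3
  to′ (n%3≡2 , refl) = trans n≡ (cong (λ q → 2 + q * 3) (sym (begin
    (n ∸ 2) / 3                ≡⟨ cong (λ m → (m ∸ 2) / 3) n≡ ⟩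
    ((2 + n / 3 * 3) ∸ 2) / 3  ≡⟨ m*n/n≡m (n / 3) 3 ⟩
    n / 3                      ∎)))
    where
    open ≡-Reasoning
    n≡ : n ≡ 2 + n / 3 * 3
    n≡ = trans (m≡m%n+[m/n]*n n 3) (cong (_+ n / 3 * 3) n%3≡2)
  from′ : ∀ {r} → n ≡ 2 + r * 3 → n % 3 ≡ 2 × r ≡ (n ∸ 2) / 3
  from′ {r} refl = [m+kn]%n≡m%n 2 r 3 , sym (m*n/n≡m r 3)

∈S⁻ : ∀ m {b v} → m / 2 ≡ b → v ∈ S m → ∃[ i ] (i < b × m % suc i ≡ v)
∈S⁻ m refl v∈S with ∈-map⁻ (λ i → m % suc i) v∈S
... | i , i∈ , refl = i , ∈-upTo⁻ i∈ , refl

∈S⁺ : ∀ m {b v} → m / 2 ≡ b → ∀ i → i < b → m % suc i ≡ v → v ∈ S m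
∈S⁺ m refl i i<b refl = ∈-map⁺ (λ i → m % suc i) (∈-upTo⁺ i<b)

T-list : ℕ → ℕ → List ℕ
T-list n m = filter (∁? (λ r → suc r ∈? S m)) (deduplicate _≟_ (S n))

∈T-list⇔∈T : ∀ n m {r} → r ∈ T-list n m ⇔ r ∈T[ n , m ]
∈T-list⇔∈T n m = mk⇔
  (λ r∈ → let r∈D , 1+r∉S = ∈-filter⁻ (∁? (λ r → suc r ∈? S m)) r∈
          in ∈-deduplicate⁻ _≟_ (S n) r∈D , 1+r∉S)
  (λ (r∈S , 1+r∉S) → ∈-filter⁺ (∁? (λ r → suc r ∈? S m)) (∈-deduplicate⁺ _≟_ r∈S) 1+r∉S)

T-list-unique : ∀ n m → Unique (T-list n m)
T-list-unique n m = filter⁺ (∁? (λ r → suc r ∈? S m)) (deduplicate-! _≟_ (S n))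

s+|T|≡s+1 : ∀ n m → 0 ∈ S m → (∀ {v} → suc v ∈ S m → v ∈ S n) →
            s m + length (T-list n m) ≡ s n + 1
s+|T|≡s+1 n m 0∈S 1+v∈S⇒v∈S = begin
  s m + length (T-list n m)                 ≡⟨ cong (_+ length (T-list n m)) s[m]≡ ⟩
  suc (length shifted + length (T-list n m)) ≡⟨ +-comm 1 _ ⟩
  length shifted + length (T-list n m) + 1   ≡⟨ cong (_+ 1) (length-filter+length-filter-∁ P? D) ⟩
  s n + 1                                    ∎
  where
  open ≡-Reasoning
  P? : Decidable (λ v → suc v ∈ S m)
  P? v = suc v ∈? S m
  D : List ℕ
  D = deduplicate _≟_ (S n)
  shifted : List ℕ
  shifted = filter P? D
  S[m]∼ : S m ∼[ set ] 0 ∷ map suc shifted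
  S[m]∼ {zero}  = mk⇔ (λ _ → here refl) (λ _ → 0∈S)
  S[m]∼ {suc v} = mk⇔
    (λ 1+v∈S → there (∈-map⁺ suc (∈-filter⁺ P? (∈-deduplicate⁺ _≟_ (1+v∈S⇒v∈S 1+v∈S)) 1+v∈S)))
    λ { (here ()) ; (there 1+v∈) → case₁ 1+v∈ }
    where
    case₁ : suc v ∈ map suc shifted → suc v ∈ S m
    case₁ 1+v∈ with ∈-map⁻ suc 1+v∈
    ... | _ , v∈ , refl = proj₂ (∈-filter⁻ P? {xs = D} v∈)
  s[m]≡ : s m ≡ suc (length shifted)
  s[m]≡ = trans (set⇒length-deduplicate≡ _≟_ 0∷shifted! S[m]∼) (cong suc (length-map suc shifted))
    where
    0∷shifted! : Unique (0 ∷ map suc shifted)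
    0∷shifted! = All-map⁺ (universal (λ _ ()) shifted)
               ∷ Unique-map⁺ suc-injective (filter⁺ P? (deduplicate-! _≟_ (S n)))

0∈S[1+h*2] : ∀ {h} → 1 ≤ h → 0 ∈ S (suc (h * 2))
0∈S[1+h*2] {h} 1≤h = ∈S⁺ (suc (h * 2)) ([1+h*2]/2≡h h) 0 1≤h (n%1≡0 (suc (h * 2)))

1+v∈S[1+h*2]⇒v∈S[h*2] : ∀ {h v} → suc v ∈ S (suc (h * 2)) → v ∈ S (h * 2)
1+v∈S[1+h*2]⇒v∈S[h*2] {h} {v} 1+v∈S with ∈S⁻ (suc (h * 2)) ([1+h*2]/2≡h h) 1+v∈S
... | i , i<h , e with %-suc-cases (h * 2) (suc i)
...   | inj₁ e′ = ∈S⁺ (h * 2) (m*n/n≡m h 2) i i<h (suc-injective (trans (sym e′) e))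
...   | inj₂ (_ , eq) = contradiction (begin
  0                                      ≡⟨ sym (m*n%n≡0 (suc (h * 2 / suc i)) (suc i)) ⟩
  suc (h * 2 / suc i) * suc i % suc i    ≡⟨ %-congˡ {o = suc i} (sym eq) ⟩
  suc (h * 2) % suc i                    ≡⟨ e ⟩
  suc v                                  ∎) 0≢1+n
  where open ≡-Reasoning

∈T[h*2,1+h*2]⇒ : ∀ {h r} → r ∈T[ h * 2 , suc (h * 2) ] → h * 2 ≡ 2 + r * 3
∈T[h*2,1+h*2]⇒ {h} (r∈S , 1+r∉S) with ∈S⁻ (h * 2) (m*n/n≡m h 2) r∈S
... | i , i<h , refl with %-suc-cases (h * 2) (suc i)
...   | inj₁ e = contradiction (∈S⁺ (suc (h * 2)) ([1+h*2]/2≡h h) i i<h e) 1+r∉S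
...   | inj₂ (1+r≡1+i , eq) with odd-multiple-cases (suc (h * 2 / suc i)) i<h eq
...     | inj₁ h*2≡ = subst (λ x → h * 2 ≡ 2 + x * 3) (sym (suc-injective 1+r≡1+i)) h*2≡
...     | inj₂ (2k≤h , e) =
  contradiction (∈S⁺ (suc (h * 2)) ([1+h*2]/2≡h h) (suc (i * 2)) 2k≤h (trans e (sym 1+r≡1+i)))
                1+r∉S

⇒∈T[h*2,1+h*2] : ∀ {h r} → h * 2 ≡ 2 + r * 3 → r ∈T[ h * 2 , suc (h * 2) ]
⇒∈T[h*2,1+h*2] {h} {r} eq = r∈S , 1+r∉S
  where
  split : ∀ r → 2 + r * 3 ≡ r + 2 * suc r
  split = solve-∀
  split′ : ∀ r → 2 + r * 3 ≡ suc r * 2 + r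
  split′ = solve-∀
  overshoot : ∀ r → suc r * 2 * 2 ≡ 2 + r * 3 + suc (1 + r)
  overshoot = solve-∀
  r<h : r < h
  r<h = *-cancelʳ-≤ (suc r) h 2 (subst (suc r * 2 ≤_) (sym (trans eq (split′ r))) (m≤m+n _ _))
  r∈S : r ∈ S (h * 2)
  r∈S = ∈S⁺ (h * 2) (m*n/n≡m h 2) r r<h (m≡r+q*k⇒m%k≡r {q = 2} (n<1+n r) (trans eq (split r)))
  1+r∉S : ¬ suc r ∈ S (suc (h * 2))
  1+r∉S 1+r∈S with ∈S⁻ (suc (h * 2)) ([1+h*2]/2≡h h) 1+r∈S
  ... | i , i<h , e = m+1+n≰m (2 + r * 3) (begin
    2 + r * 3 + suc (1 + r)  ≡⟨ overshoot r ⟨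
    suc r * 2 * 2            ≤⟨ *-monoˡ-≤ 2 (subst (_≤ h) k≡ i<h) ⟩
    h * 2                    ≡⟨ eq ⟩
    2 + r * 3                ∎)
    where
    open ≤-Reasoning
    e′ : suc r * 3 % suc i ≡ suc r
    e′ = subst (λ x → x % suc i ≡ suc r) (cong suc eq) e
    k≡ : suc i ≡ suc r * 2
    k≡ = m*3%k≡m⇒k≡m*2 (subst (_< suc i) e (m%n<n (suc (h * 2)) (suc i))) e′

proposition4p5 : (n : ℕ) → 2 ≤ n → 2 ∣ n →
    ((r : ℕ) → (r ∈T[ n , n + 1 ]) ⇔ ((n % 3 ≡ 2) × (r ≡ (n ∸ 2) / 3)))
    × ((n % 3 ≡ 2 → s (n + 1) ≡ s n) × (¬ (n % 3 ≡ 2) → s (n + 1) ≡ s n + 1))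
proposition4p5 .(h * 2) 2≤n (divides h refl) rewrite +-comm (h * 2) 1 =
  T-char , s-equal , s-grows
  where
  n = h * 2
  T-char : ∀ r → r ∈T[ n , suc n ] ⇔ (n % 3 ≡ 2 × r ≡ (n ∸ 2) / 3)
  T-char r = ⇔-sym n%3≡2×r≡[n∸2]/3⇔n≡2+r*3 ⇔-∘ mk⇔ (∈T[h*2,1+h*2]⇒ {h}) (⇒∈T[h*2,1+h*2] {h})
  ∈T-list : ∀ {r} → r ∈ T-list n (suc n) ⇔ (n % 3 ≡ 2 × r ≡ (n ∸ 2) / 3)
  ∈T-list {r} = T-char r ⇔-∘ ∈T-list⇔∈T n (suc n)
  count : s (suc n) + length (T-list n (suc n)) ≡ s n + 1
  count = s+|T|≡s+1 n (suc n) (0∈S[1+h*2] (*-cancelʳ-≤ 1 h 2 2≤n)) (1+v∈S[1+h*2]⇒v∈S[h*2] {h})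
  s-equal : n % 3 ≡ 2 → s (suc n) ≡ s n
  s-equal n%3≡2 = +-cancelʳ-≡ 1 _ _ (trans (cong (s (suc n) +_) (sym |T|≡1)) count)
    where
    |T|≡1 : length (T-list n (suc n)) ≡ 1
    |T|≡1 = unique∧⇔≡⇒length≡1 (T-list-unique n (suc n))
              (mk⇔ (λ r∈ → proj₂ (to ∈T-list r∈)) (λ r≡ → from ∈T-list (n%3≡2 , r≡)))
  s-grows : ¬ (n % 3 ≡ 2) → s (suc n) ≡ s n + 1
  s-grows n%3≢2 = trans (sym (+-identityʳ _)) (trans (cong (s (suc n) +_) (sym |T|≡0)) count)
    where
    |T|≡0 : length (T-list n (suc n)) ≡ 0
    |T|≡0 = ∉⇒length≡0 (λ r∈ → n%3≢2 (proj₁ (to ∈T-list r∈)))
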